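{- Let $\mathbf{L}=\langle L,\leq\rangle$ be a complete lattice, $S$ an $L$-parameterization, and $S'$ the monoid generated by $S$. Then for any $M\subseteq L$ and any $a\in L$, $$C_M(a)=\bigwedge\{h(m);\ m\in M,\ \langle f,h\rangle\in S',\ a\leq h(m)\}.$$
   Context: An isotone Galois connection in $\mathbf{L}$ is a pair $\langle f,h\rangle$ of maps $L\to L$ with $f(a)\leq b$ iff $a\leq h(b)$; composition $\langle f_1,h_1\rangle\circ\langle f_2,h_2\rangle=\langle f_1f_2,h_2h_1\rangle$. An $L$-parameterization is a set $S$ of isotone Galois connections containing $\langle\mathrm{id},\mathrm{id}\rangle$. $S'$ is the set of all finite compositions of elements of $S$. For $a,b\in L$, $M\models a\Rightarrow b$ means: for all $m\in M$ and $\langle f,h\rangle\in S'$, $f(a)\leq m$ implies $f(b)\leq m$. $C_M(a)=\bigvee\{b\in L;\ M\models a\Rightarrow b\}$. -}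

module Defs where

open import Level using (Level; suc; _⊔_)
open import Data.Product using (Σ; _×_; _,_; ∃)
open import Function using (_∘_; id)
open import Function.Bundles using (_⇔_; mk⇔; module Equivalence)
open import Relation.Binary.Core using (Rel)
open import Relation.Binary.Structures using (IsPartialOrder)
open import Relation.Binary.PropositionalEquality using (_≡_)
open import Relation.Unary using (Pred; _∈_)

record CompleteLattice (ℓ : Level) : Set (suc ℓ) where
  field
    Carrier        : Set ℓ
    _≈_            : Rel Carrier ℓ
    _≤_            : Rel Carrier ℓ
    isPartialOrder : IsPartialOrder _≈_ _≤_
    ⋁              : Pred Carrier ℓ → Carrier
    ⋁-upper        : ∀ (X : Pred Carrier ℓ) x → x ∈ X → x ≤ ⋁ X
    ⋁-least        : ∀ (X : Pred Carrier ℓ) y → (∀ x → x ∈ X → x ≤ y) → ⋁ X ≤ y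
    ⋀              : Pred Carrier ℓ → Carrier
    ⋀-lower        : ∀ (X : Pred Carrier ℓ) x → x ∈ X → ⋀ X ≤ x
    ⋀-greatest     : ∀ (X : Pred Carrier ℓ) y → (∀ x → x ∈ X → y ≤ x) → y ≤ ⋀ X

module _ {ℓ : Level} (𝐋 : CompleteLattice ℓ) where
  open CompleteLattice 𝐋

  record GaloisConnection : Set ℓ where
    constructor ⟨_,_⟩[_]
    field
      f   : Carrier → Carrier
      h   : Carrier → Carrier
      adj : ∀ a b → (f a ≤ b) ⇔ (a ≤ h b)

  open GaloisConnection public

  idGC : GaloisConnection
  idGC = ⟨ id , id ⟩[ (λ a b → mk⇔ id id) ]

  _∘GC_ : GaloisConnection → GaloisConnection → GaloisConnection
  g₁ ∘GC g₂ = ⟨ f g₁ ∘ f g₂ , h g₂ ∘ h g₁ ⟩[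
    (λ a b → mk⇔
      (λ p → Equivalence.to (adj g₂ a (h g₁ b)) (Equivalence.to (adj g₁ (f g₂ a) b) p))
      (λ q → Equivalence.from (adj g₁ (f g₂ a) b) (Equivalence.from (adj g₂ a (h g₁ b)) q))) ]

  record Parameterization : Set (suc ℓ) where
    field
      S     : Pred GaloisConnection ℓ
      S-id  : idGC ∈ S

  data Closure (S : Pred GaloisConnection ℓ) : Pred GaloisConnection ℓ where
    gen  : ∀ {g} → g ∈ S → Closure S g
    comp : ∀ {g₁ g₂} → Closure S g₁ → Closure S g₂ → Closure S (g₁ ∘GC g₂)

  module _ (P : Parameterization) where
    open Parameterization P

    S' : Pred GaloisConnection ℓ
    S' = Closure S

    _⊨_⇒_ : Pred Carrier ℓ → Carrier → Carrier → Set ℓ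
    M ⊨ a ⇒ b = ∀ m → m ∈ M → ∀ g → g ∈ S' → f g a ≤ m → f g b ≤ m

    C : Pred Carrier ℓ → Carrier → Carrier
    C M a = ⋁ (λ b → M ⊨ a ⇒ b)

    HSet : Pred Carrier ℓ → Carrier → Pred Carrier ℓ
    HSet M a x = Σ Carrier λ m → Σ GaloisConnection λ g →
                   (m ∈ M) × (g ∈ S') × (a ≤ h g m) × (x ≡ h g m)

-- M ⊨ a ⇒ b holds exactly when b lies below every h(m) with a ≤ h(m): by
-- adjunction, f(a) ≤ m reads a ≤ h(m) and f(b) ≤ m reads b ≤ h(m).  So the
-- b's entailed by a form the principal down-set of ⋀ {h(m) ; a ≤ h(m)}, and
-- C_M(a), the join of that down-set, is its top element.

module Submission where

open import Defs
open import Level using (Level)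
open import Relation.Unary using (Pred; _∈_)
open import Data.Product using (_,_)
open import Function.Bundles using (_⇔_; mk⇔; module Equivalence)
open import Relation.Binary.PropositionalEquality using (refl)
open import Relation.Binary.Structures using (IsPartialOrder)

module _ {ℓ : Level} (𝐋 : CompleteLattice ℓ) where
  open CompleteLattice 𝐋
  open IsPartialOrder isPartialOrder using (antisym; trans)
  open Equivalence using (to; from)

  ⋁-greatest-element : ∀ (X : Pred Carrier ℓ) k →
                       k ∈ X → (∀ x → x ∈ X → x ≤ k) → ⋁ X ≈ k
  ⋁-greatest-element X k k∈X k-upper =
    antisym (⋁-least X k k-upper) (⋁-upper X k k∈X)

  module _ (P : Parameterization 𝐋) (M : Pred Carrier ℓ) where

    ⊨⇒⇔≤⋀HSet : ∀ a b → (_⊨_⇒_ 𝐋 P M a b) ⇔ (b ≤ ⋀ (HSet 𝐋 P M a))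
    ⊨⇒⇔≤⋀HSet a b = mk⇔ entailed⇒below below⇒entailed
      where
      entailed⇒below : _⊨_⇒_ 𝐋 P M a b → b ≤ ⋀ (HSet 𝐋 P M a)
      entailed⇒below a⇒b = ⋀-greatest _ b λ where
        _ (m , g , m∈M , g∈S' , a≤hm , refl) →
          to (adj g b m) (a⇒b m m∈M g g∈S' (from (adj g a m) a≤hm))

      below⇒entailed : b ≤ ⋀ (HSet 𝐋 P M a) → _⊨_⇒_ 𝐋 P M a b
      below⇒entailed b≤⋀ m m∈M g g∈S' fa≤m = from (adj g b m)
        (trans b≤⋀ (⋀-lower _ (h g m)
          (m , g , m∈M , g∈S' , to (adj g a m) fa≤m , refl)))

theorem29 : ∀ {ℓ : Level} (𝐋 : CompleteLattice ℓ) (P : Parameterization 𝐋)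
              (M : Pred (CompleteLattice.Carrier 𝐋) ℓ) (a : CompleteLattice.Carrier 𝐋) →
              CompleteLattice._≈_ 𝐋 (C 𝐋 P M a) (CompleteLattice.⋀ 𝐋 (HSet 𝐋 P M a))
theorem29 𝐋 P M a =
  ⋁-greatest-element 𝐋 _ (⋀ (HSet 𝐋 P M a))
    (from (⊨⇒⇔≤⋀HSet 𝐋 P M a _) ≤-refl)
    (λ b → to (⊨⇒⇔≤⋀HSet 𝐋 P M a b))
  where
  open CompleteLattice 𝐋 using (⋀)
  open IsPartialOrder (CompleteLattice.isPartialOrder 𝐋) using () renaming (refl to ≤-refl)
  open Equivalence using (to; from)
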